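{- Let $\mathcal{K}$ be the set of all positions of misère partizan Kayles, and let $k,j$ be positive integers. Then $$kS_1+jS_2\equiv\{(k-1)S_1+jS_2 \mid kS_1+(j-1)S_2\}\pmod{\mathcal{K}},$$ where the right-hand side is the game whose only Left option is $(k-1)S_1+jS_2$ and whose only Right option is $kS_1+(j-1)S_2$.
   Context: Partizan Kayles is played on $1\times n$ strips of squares; $S_n$ denotes an empty strip of length $n$, and $mG$ denotes the disjunctive sum of $m$ copies of $G$. Left moves by placing a single square on one empty cell; Right moves by placing a domino covering two adjacent empty cells of the same strip; a placement splits a strip into the strips of empty cells on either side. $\mathcal{K}$ is the set of all disjunctive sums of strips. A game is written $\{A\mid B\}$ with $A$ its Left options and $B$ its Right options. Under misère play a player unable to move on their turn wins; $o^-(G)$ is the misère outcome. For games $G,H$, $G\equiv H\pmod{\mathcal{K}}$ means $o^-(G+X)=o^-(H+X)$ for all $X\in\mathcal{K}$. -}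

module Defs where

open import Data.Nat using (ℕ; zero; suc; _+_; _∸_)
open import Data.Fin using (Fin; toℕ; splitAt)
open import Data.Sum using ([_,_]′)
open import Data.Bool using (Bool; true; false; _∨_; not)
open import Data.List using (List; []; _∷_)

data Game : Set where
  mk : (nL : ℕ) → (Fin nL → Game) → (nR : ℕ) → (Fin nR → Game) → Game

𝟘 : Game
𝟘 = mk 0 (λ ()) 0 (λ ())

infixl 6 _⊕_
_⊕_ : Game → Game → Game
mk a L b R ⊕ mk c L' d R' =
  mk (a + c)
     (λ i → [ (λ x → L x ⊕ mk c L' d R') , (λ y → mk a L b R ⊕ L' y) ]′ (splitAt a i))
     (b + d)
     (λ i → [ (λ x → R x ⊕ mk c L' d R') , (λ y → mk a L b R ⊕ R' y) ]′ (splitAt b i))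

_·_ : ℕ → Game → Game
zero  · G = 𝟘
suc m · G = G ⊕ (m · G)

anyFin : (n : ℕ) → (Fin n → Bool) → Bool
anyFin zero    f = false
anyFin (suc n) f = f Fin.zero ∨ anyFin n (λ i → f (Fin.suc i))

-- Misère play (a player unable to move on their turn wins).
-- leftWinsFirst G : Left wins G moving first; rightWinsFirst G : Right wins moving first.
mutual
  leftWinsFirst : Game → Bool
  leftWinsFirst (mk zero L nR R) = true
  leftWinsFirst (mk (suc n) L nR R) = anyFin (suc n) (λ i → not (rightWinsFirst (L i)))

  rightWinsFirst : Game → Bool
  rightWinsFirst (mk nL L zero R) = true
  rightWinsFirst (mk nL L (suc n) R) = anyFin (suc n) (λ i → not (leftWinsFirst (R i)))

data Outcome : Set where
  𝓛 𝓝 𝓟 𝓡 : Outcome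

classify : Bool → Bool → Outcome
classify true  false = 𝓛   -- Left wins moving first and moving second
classify true  true  = 𝓝
classify false false = 𝓟
classify false true  = 𝓡

o⁻ : Game → Outcome
o⁻ G = classify (leftWinsFirst G) (rightWinsFirst G)

-- Partizan Kayles strips. strip′ f n uses fuel f; it is correct whenever n ≤ f
-- (option lengths are < n), so S n := strip′ n n.
-- Left: a square on cell i (0 ≤ i < n) leaves S_i + S_{n-1-i}.
-- Right: a domino on cells i,i+1 (0 ≤ i < n-1) leaves S_i + S_{n-2-i}.
strip′ : ℕ → ℕ → Game
strip′ zero    n = 𝟘
strip′ (suc f) n =
  mk n       (λ i → strip′ f (toℕ i) ⊕ strip′ f (n ∸ 1 ∸ toℕ i))
     (n ∸ 1) (λ i → strip′ f (toℕ i) ⊕ strip′ f (n ∸ 2 ∸ toℕ i))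

S : ℕ → Game
S n = strip′ n n

kayles : List ℕ → Game
kayles []       = 𝟘
kayles (n ∷ ns) = S n ⊕ kayles ns

_≡mod𝒦_ : Game → Game → Set
G ≡mod𝒦 H = (xs : List ℕ) → o⁻ (G ⊕ kayles xs) Relation.Binary.PropositionalEquality.≡ o⁻ (H ⊕ kayles xs)
  where import Relation.Binary.PropositionalEquality

⟨_∣_⟩ : Game → Game → Game
⟨ A ∣ B ⟩ = mk 1 (λ _ → A) 1 (λ _ → B)

-- Give the strip S_n the weight 0, -1, +1 according as n ≡ 0, 1, 2 (mod 3), and a disjunctive
-- sum the sum of the weights.  Then every Left move changes the weight by +1 or -2 and every
-- Right move by -1 or +2; Right, if she can move, has a move of -1, and if she cannot, the
-- weight is ≤ 0; Left, if she cannot move, faces weight 0, and otherwise has a move of +1 or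
-- else faces a positive weight and has a move of -2.  These properties (Weighted below) are
-- preserved by sums, and by induction they determine the misère outcome from the weight D:
-- Left moving first wins iff D ≥ 0 and D ≡ 0, Right moving first wins iff D < 0 or D ≢ 1
-- (mod 3).  The game {(k-1)S_1 + jS_2 | kS_1 + (j-1)S_2} has them with the weight j - k of
-- kS_1 + jS_2, as its two options have weights j - k + 1 and j - k - 1.
module Submission where

open import Defs
open import Data.Nat as ℕ using (ℕ; zero; suc; _∸_; _≤_; _<_; z≤n; s≤s)
import Data.Nat.Properties as ℕₚ
open import Data.Integer as ℤ using (ℤ; +_; -[1+_]; 0ℤ; 1ℤ; -1ℤ; _+_; _*_; +≤+; -≤+; +<+)
import Data.Integer.Properties as ℤₚ
open import Data.Integer.Tactic.RingSolver using (solve-∀)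
open import Data.Fin using (Fin; toℕ; splitAt; _↑ˡ_; _↑ʳ_)
import Data.Fin.Properties as Finₚ
open import Data.Sum as Sum using (_⊎_; inj₁; inj₂; [_,_]′)
open import Data.Product as Prod using (∃; _×_; _,_; proj₁; proj₂)
open import Function using (_∘_)
open import Data.Bool using (Bool; true; false; not)
open import Data.List using (List; []; _∷_)
open import Relation.Binary.PropositionalEquality

2ℤ -2ℤ : ℤ
2ℤ = + 2
-2ℤ = -[1+ 1 ]

data Mod3 : Set where
  0₃ 1₃ 2₃ : Mod3

suc₃ : Mod3 → Mod3
suc₃ 0₃ = 1₃
suc₃ 1₃ = 2₃
suc₃ 2₃ = 0₃

infixl 6 _+₃_
_+₃_ : Mod3 → Mod3 → Mod3
0₃ +₃ y = y
1₃ +₃ y = suc₃ y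
2₃ +₃ y = suc₃ (suc₃ y)

residue : ℕ → Mod3
residue zero    = 0₃
residue (suc n) = suc₃ (residue n)

suc₃-+₃ : ∀ x y → suc₃ (x +₃ y) ≡ suc₃ x +₃ y
suc₃-+₃ 0₃ y  = refl
suc₃-+₃ 1₃ y  = refl
suc₃-+₃ 2₃ 0₃ = refl
suc₃-+₃ 2₃ 1₃ = refl
suc₃-+₃ 2₃ 2₃ = refl

residue-+ : ∀ a b → residue (a ℕ.+ b) ≡ residue a +₃ residue b
residue-+ zero    b = refl
residue-+ (suc a) b = trans (cong suc₃ (residue-+ a b)) (suc₃-+₃ (residue a) (residue b))

leftWins : ℤ → Bool
leftWins -[1+ _ ] = false
leftWins (+ n) with residue n
... | 0₃ = true
... | _  = false

rightWins : ℤ → Bool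
rightWins -[1+ _ ] = true
rightWins (+ n) with residue n
... | 1₃ = false
... | _  = true

¬leftWins⇒rightWins[1+] : ∀ D → leftWins D ≡ false → rightWins (1ℤ + D) ≡ true
¬leftWins⇒rightWins[1+] -[1+ zero ]  _ = refl
¬leftWins⇒rightWins[1+] -[1+ suc _ ] _ = refl
¬leftWins⇒rightWins[1+] (+ n) e with residue n
... | 1₃ = refl
... | 2₃ = refl

¬leftWins⇒rightWins[-2+] : ∀ D → leftWins D ≡ false → rightWins (-2ℤ + D) ≡ true
¬leftWins⇒rightWins[-2+] -[1+ _ ] _ = refl
¬leftWins⇒rightWins[-2+] (+ zero)          _ = refl
¬leftWins⇒rightWins[-2+] (+ suc zero)      _ = refl
¬leftWins⇒rightWins[-2+] (+ suc (suc n)) e with residue n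
... | 0₃ = refl
... | 2₃ = refl

leftWins⇒¬rightWins[1+] : ∀ D → leftWins D ≡ true → rightWins (1ℤ + D) ≡ false
leftWins⇒¬rightWins[1+] (+ n) e with residue n
... | 0₃ = refl

leftWins⇒¬rightWins[-2+] : ∀ D → leftWins D ≡ true → 0ℤ ℤ.< D → rightWins (-2ℤ + D) ≡ false
leftWins⇒¬rightWins[-2+] (+ zero)        _  (+<+ ())
leftWins⇒¬rightWins[-2+] (+ suc zero)    () _
leftWins⇒¬rightWins[-2+] (+ suc (suc n)) e  _ with residue n
... | 1₃ = refl

¬rightWins⇒leftWins[-1+] : ∀ D → rightWins D ≡ false → leftWins (-1ℤ + D) ≡ true
¬rightWins⇒leftWins[-1+] (+ suc n) e with residue n
... | 0₃ = refl

¬rightWins⇒leftWins[2+] : ∀ D → rightWins D ≡ false → leftWins (2ℤ + D) ≡ true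
¬rightWins⇒leftWins[2+] (+ n) e with residue n
... | 1₃ = refl

rightWins⇒¬leftWins[-1+] : ∀ D → rightWins D ≡ true → leftWins (-1ℤ + D) ≡ false
rightWins⇒¬leftWins[-1+] -[1+ _ ] _ = refl
rightWins⇒¬leftWins[-1+] (+ zero)  _ = refl
rightWins⇒¬leftWins[-1+] (+ suc n) e with residue n
... | 1₃ = refl
... | 2₃ = refl

nonpositive⇒rightWins : ∀ {D} → D ℤ.≤ 0ℤ → rightWins D ≡ true
nonpositive⇒rightWins { -[1+ _ ]} _ = refl
nonpositive⇒rightWins {+ zero}   _ = refl
nonpositive⇒rightWins {+ suc _}  (+≤+ ())

data Weighted : Game → ℤ → Set where
  weighted : ∀ {nL L nR R D} →
    (∀ i → Weighted (L i) (1ℤ + D) ⊎ Weighted (L i) (-2ℤ + D)) →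
    (∀ i → Weighted (R i) (-1ℤ + D) ⊎ Weighted (R i) (2ℤ + D)) →
    (nL ≡ 0 → D ≡ 0ℤ) →
    (nR ≡ 0 → D ℤ.≤ 0ℤ) →
    (0 < nR → ∃ λ i → Weighted (R i) (-1ℤ + D)) →
    (∃ (λ i → Weighted (L i) (1ℤ + D)) ⊎ (0 < nL → 0ℤ ℤ.< D × ∃ λ i → Weighted (L i) (-2ℤ + D))) →
    Weighted (mk nL L nR R) D

LeftGood : Game → ℤ → Set
LeftGood (mk nL L _ _) D =
  ∃ (λ i → Weighted (L i) (1ℤ + D)) ⊎ (0 < nL → 0ℤ ℤ.< D × ∃ λ i → Weighted (L i) (-2ℤ + D))

anyFin-false : ∀ n (f : Fin n → Bool) → (∀ i → f i ≡ false) → anyFin n f ≡ false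
anyFin-false zero    f _ = refl
anyFin-false (suc n) f h rewrite h Fin.zero =
  anyFin-false n (λ i → f (Fin.suc i)) (λ i → h (Fin.suc i))

anyFin-true : ∀ n (f : Fin n → Bool) → ∃ (λ i → f i ≡ true) → anyFin n f ≡ true
anyFin-true (suc n) f (Fin.zero , e) rewrite e = refl
anyFin-true (suc n) f (Fin.suc i , e) with f Fin.zero
... | true  = refl
... | false = anyFin-true n (λ i → f (Fin.suc i)) (i , e)

mutual
  leftWinsFirst-weighted : ∀ {G D} → Weighted G D → leftWinsFirst G ≡ leftWins D
  leftWinsFirst-weighted (weighted {zero} _ _ noLeft _ _ _) rewrite noLeft refl = refl
  leftWinsFirst-weighted {D = D} (weighted {suc n} {L} {nR} {R} moves _ _ _ _ good) with leftWins D in eq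
  ... | false = anyFin-false (suc n) _ (λ i → cong not (answered i (moves i)))
    where
    answered : ∀ i → Weighted (L i) (1ℤ + D) ⊎ Weighted (L i) (-2ℤ + D) → rightWinsFirst (L i) ≡ true
    answered i (inj₁ w) = trans (rightWinsFirst-weighted w) (¬leftWins⇒rightWins[1+] D eq)
    answered i (inj₂ w) = trans (rightWinsFirst-weighted w) (¬leftWins⇒rightWins[-2+] D eq)
  ... | true = anyFin-true (suc n) _ (winning good)
    where
    winning : LeftGood (mk (suc n) L nR R) D → ∃ λ i → not (rightWinsFirst (L i)) ≡ true
    winning (inj₁ (i , w)) = i , cong not (trans (rightWinsFirst-weighted w) (leftWins⇒¬rightWins[1+] D eq))
    winning (inj₂ h) with h (s≤s z≤n)
    ... | D>0 , i , w = i , cong not (trans (rightWinsFirst-weighted w) (leftWins⇒¬rightWins[-2+] D eq D>0))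

  rightWinsFirst-weighted : ∀ {G D} → Weighted G D → rightWinsFirst G ≡ rightWins D
  rightWinsFirst-weighted (weighted {nR = zero} _ _ _ noRight _ _) =
    sym (nonpositive⇒rightWins (noRight refl))
  rightWinsFirst-weighted {D = D} (weighted {nR = suc n} {R} _ moves _ _ down _) with rightWins D in eq
  ... | false = anyFin-false (suc n) _ (λ i → cong not (answered i (moves i)))
    where
    answered : ∀ i → Weighted (R i) (-1ℤ + D) ⊎ Weighted (R i) (2ℤ + D) → leftWinsFirst (R i) ≡ true
    answered i (inj₁ w) = trans (leftWinsFirst-weighted w) (¬rightWins⇒leftWins[-1+] D eq)
    answered i (inj₂ w) = trans (leftWinsFirst-weighted w) (¬rightWins⇒leftWins[2+] D eq)
  ... | true = anyFin-true (suc n) _ (winning (down (s≤s z≤n)))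
    where
    winning : ∃ (λ i → Weighted (R i) (-1ℤ + D)) → ∃ λ i → not (leftWinsFirst (R i)) ≡ true
    winning (i , w) = i , cong not (trans (leftWinsFirst-weighted w) (rightWins⇒¬leftWins[-1+] D eq))

o⁻-weighted : ∀ {G D} → Weighted G D → o⁻ G ≡ classify (leftWins D) (rightWins D)
o⁻-weighted w = cong₂ classify (leftWinsFirst-weighted w) (rightWinsFirst-weighted w)

𝟘-weighted : Weighted 𝟘 0ℤ
𝟘-weighted = weighted (λ ()) (λ ()) (λ _ → refl) (λ _ → ℤₚ.≤-refl) (λ ()) (inj₂ (λ ()))

⟨∣⟩-weighted : ∀ {A B D} → Weighted A (1ℤ + D) → Weighted B (-1ℤ + D) → Weighted ⟨ A ∣ B ⟩ D
⟨∣⟩-weighted wA wB =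
  weighted (λ _ → inj₁ wA) (λ _ → inj₁ wB) (λ ()) (λ ()) (λ _ → Fin.zero , wB) (inj₁ (Fin.zero , wA))

weight-nonnegative : ∀ {nL D} {X : Set} → (nL ≡ 0 → D ≡ 0ℤ) → (0 < nL → 0ℤ ℤ.< D × X) → 0ℤ ℤ.≤ D
weight-nonnegative {zero}  noLeft _ = ℤₚ.≤-reflexive (sym (noLeft refl))
weight-nonnegative {suc _} _ good   = ℤₚ.<⇒≤ (proj₁ (good (s≤s z≤n)))

positive-+ : ∀ a {c} → 0 < a ℕ.+ c → 0 < a ⊎ 0 < c
positive-+ zero    c>0 = inj₂ c>0
positive-+ (suc _) _   = inj₁ (s≤s z≤n)

module _ {X : Set} (P : X → Set) {a c} {f : Fin a → X} {g : Fin c → X} where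

  all-splitAt : (∀ x → P (f x)) → (∀ y → P (g y)) → ∀ i → P ([ f , g ]′ (splitAt a i))
  all-splitAt pf pg i with splitAt a i
  ... | inj₁ x = pf x
  ... | inj₂ y = pg y

  any-splitAt : ∃ (λ x → P (f x)) ⊎ ∃ (λ y → P (g y)) → ∃ λ i → P ([ f , g ]′ (splitAt a i))
  any-splitAt (inj₁ (x , p)) = x ↑ˡ c , subst (λ s → P ([ f , g ]′ s)) (sym (Finₚ.splitAt-↑ˡ a x c)) p
  any-splitAt (inj₂ (y , p)) = a ↑ʳ y , subst (λ s → P ([ f , g ]′ s)) (sym (Finₚ.splitAt-↑ʳ a c y)) p

-- The shift-* helpers take the sub-derivations apart by pattern matching, which keeps every
-- recursive call of ⊕-weighted visibly structural for the termination checker.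
mutual
  ⊕-weighted : ∀ {G H D E} → Weighted G D → Weighted H E → Weighted (G ⊕ H) (D + E)
  ⊕-weighted {mk a L b R} {mk c L′ d R′} {D} {E}
             wG@(weighted leftG rightG noLeftG noRightG downG goodG)
             wH@(weighted leftH rightH noLeftH noRightH downH goodH) =
    weighted
      (all-splitAt (λ X → Weighted X (1ℤ + (D + E)) ⊎ Weighted X (-2ℤ + (D + E)))
         (λ x → shift-⊎ˡ 1ℤ -2ℤ D (leftG x) wH) (λ y → shift-⊎ʳ 1ℤ -2ℤ E wG (leftH y)))
      (all-splitAt (λ X → Weighted X (-1ℤ + (D + E)) ⊎ Weighted X (2ℤ + (D + E)))
         (λ x → shift-⊎ˡ -1ℤ 2ℤ D (rightG x) wH) (λ y → shift-⊎ʳ -1ℤ 2ℤ E wG (rightH y)))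
      (λ a+c≡0 → cong₂ _+_ (noLeftG (ℕₚ.m+n≡0⇒m≡0 a a+c≡0)) (noLeftH (ℕₚ.m+n≡0⇒n≡0 a a+c≡0)))
      (λ b+d≡0 → ℤₚ.+-mono-≤ (noRightG (ℕₚ.m+n≡0⇒m≡0 b b+d≡0)) (noRightH (ℕₚ.m+n≡0⇒n≡0 b b+d≡0)))
      (λ b+d>0 → any-splitAt (λ X → Weighted X (-1ℤ + (D + E)))
         (Sum.map (λ b>0 → shift-∃ˡ -1ℤ D (downG b>0) wH) (λ d>0 → shift-∃ʳ -1ℤ E wG (downH d>0))
                  (positive-+ b b+d>0)))
      (⊕-leftGood wG wH)

  ⊕-leftGood : ∀ {a L b R c L′ d R′ D E} → Weighted (mk a L b R) D → Weighted (mk c L′ d R′) E →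
               LeftGood (mk a L b R ⊕ mk c L′ d R′) (D + E)
  ⊕-leftGood {D = D} {E} (weighted _ _ _ _ _ (inj₁ up)) wH =
    inj₁ (any-splitAt (λ X → Weighted X (1ℤ + (D + E))) (inj₁ (shift-∃ˡ 1ℤ D up wH)))
  ⊕-leftGood {D = D} {E} wG (weighted _ _ _ _ _ (inj₁ up)) =
    inj₁ (any-splitAt (λ X → Weighted X (1ℤ + (D + E))) (inj₂ (shift-∃ʳ 1ℤ E wG up)))
  ⊕-leftGood {a} {D = D} {E} wG@(weighted _ _ noLeftG _ _ (inj₂ hG))
                             wH@(weighted _ _ noLeftH _ _ (inj₂ hH)) =
    inj₂ λ a+c>0 →
      [ (λ a>0 → Prod.map₂ (any-splitAt (λ X → Weighted X (-2ℤ + (D + E))) ∘ inj₁)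
                           (shift-downˡ D (weight-nonnegative noLeftH hH) (hG a>0) wH))
      , (λ c>0 → Prod.map₂ (any-splitAt (λ X → Weighted X (-2ℤ + (D + E))) ∘ inj₂)
                           (shift-downʳ E (weight-nonnegative noLeftG hG) wG (hH c>0)))
      ]′ (positive-+ a a+c>0)

  shiftˡ : ∀ s D {E G H} → Weighted G (s + D) → Weighted H E → Weighted (G ⊕ H) (s + (D + E))
  shiftˡ s D {E} wG wH = subst (Weighted _) (ℤₚ.+-assoc s D E) (⊕-weighted wG wH)

  shiftʳ : ∀ s E {D G H} → Weighted G D → Weighted H (s + E) → Weighted (G ⊕ H) (s + (D + E))
  shiftʳ s E {D} wG wH = subst (Weighted _) (swap-+ D s E) (⊕-weighted wG wH)
    where
    swap-+ : ∀ x y z → x + (y + z) ≡ y + (x + z)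
    swap-+ = solve-∀

  shift-⊎ˡ : ∀ s t D {E G H} → Weighted G (s + D) ⊎ Weighted G (t + D) → Weighted H E →
             Weighted (G ⊕ H) (s + (D + E)) ⊎ Weighted (G ⊕ H) (t + (D + E))
  shift-⊎ˡ s t D (inj₁ wG) wH = inj₁ (shiftˡ s D wG wH)
  shift-⊎ˡ s t D (inj₂ wG) wH = inj₂ (shiftˡ t D wG wH)

  shift-⊎ʳ : ∀ s t E {D G H} → Weighted G D → Weighted H (s + E) ⊎ Weighted H (t + E) →
             Weighted (G ⊕ H) (s + (D + E)) ⊎ Weighted (G ⊕ H) (t + (D + E))
  shift-⊎ʳ s t E wG (inj₁ wH) = inj₁ (shiftʳ s E wG wH)
  shift-⊎ʳ s t E wG (inj₂ wH) = inj₂ (shiftʳ t E wG wH)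

  shift-∃ˡ : ∀ s D {E n} {F : Fin n → Game} {H} → ∃ (λ x → Weighted (F x) (s + D)) → Weighted H E →
             ∃ λ x → Weighted (F x ⊕ H) (s + (D + E))
  shift-∃ˡ s D (x , wG) wH = x , shiftˡ s D wG wH

  shift-∃ʳ : ∀ s E {D n} {G} {F : Fin n → Game} → Weighted G D → ∃ (λ y → Weighted (F y) (s + E)) →
             ∃ λ y → Weighted (G ⊕ F y) (s + (D + E))
  shift-∃ʳ s E wG (y , wH) = y , shiftʳ s E wG wH

  shift-downˡ : ∀ D {E n} {F : Fin n → Game} {H} → 0ℤ ℤ.≤ E →
                0ℤ ℤ.< D × ∃ (λ x → Weighted (F x) (-2ℤ + D)) → Weighted H E →
                0ℤ ℤ.< D + E × ∃ λ x → Weighted (F x ⊕ H) (-2ℤ + (D + E))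
  shift-downˡ D E≥0 (D>0 , down) wH = ℤₚ.+-mono-<-≤ D>0 E≥0 , shift-∃ˡ -2ℤ D down wH

  shift-downʳ : ∀ E {D n} {G} {F : Fin n → Game} → 0ℤ ℤ.≤ D → Weighted G D →
                0ℤ ℤ.< E × ∃ (λ y → Weighted (F y) (-2ℤ + E)) →
                0ℤ ℤ.< D + E × ∃ λ y → Weighted (G ⊕ F y) (-2ℤ + (D + E))
  shift-downʳ E D≥0 wG (E>0 , down) = ℤₚ.+-mono-≤-< D≥0 E>0 , shift-∃ʳ -2ℤ E wG down

·-weighted : ∀ m {G D} → Weighted G D → Weighted (m · G) (+ m * D)
·-weighted zero    _ = 𝟘-weighted
·-weighted (suc m) {D = D} w =
  subst (Weighted _) (sym (ℤₚ.suc-* (+ m) D)) (⊕-weighted w (·-weighted m w))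

weightOf : Mod3 → ℤ
weightOf 0₃ = 0ℤ
weightOf 1₃ = -1ℤ
weightOf 2₃ = 1ℤ

stripWeight : ℕ → ℤ
stripWeight n = weightOf (residue n)

square-weights : ∀ x y → weightOf x + weightOf y ≡ 1ℤ + weightOf (suc₃ (x +₃ y))
                       ⊎ weightOf x + weightOf y ≡ -2ℤ + weightOf (suc₃ (x +₃ y))
square-weights 0₃ 0₃ = inj₁ refl
square-weights 0₃ 1₃ = inj₂ refl
square-weights 0₃ 2₃ = inj₁ refl
square-weights 1₃ 0₃ = inj₂ refl
square-weights 1₃ 1₃ = inj₂ refl
square-weights 1₃ 2₃ = inj₁ refl
square-weights 2₃ 0₃ = inj₁ refl
square-weights 2₃ 1₃ = inj₁ refl
square-weights 2₃ 2₃ = inj₁ refl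

domino-weights : ∀ x y → weightOf x + weightOf y ≡ -1ℤ + weightOf (suc₃ (suc₃ (x +₃ y)))
                       ⊎ weightOf x + weightOf y ≡ 2ℤ + weightOf (suc₃ (suc₃ (x +₃ y)))
domino-weights 0₃ 0₃ = inj₁ refl
domino-weights 0₃ 1₃ = inj₁ refl
domino-weights 0₃ 2₃ = inj₂ refl
domino-weights 1₃ 0₃ = inj₁ refl
domino-weights 1₃ 1₃ = inj₁ refl
domino-weights 1₃ 2₃ = inj₁ refl
domino-weights 2₃ 0₃ = inj₂ refl
domino-weights 2₃ 1₃ = inj₁ refl
domino-weights 2₃ 2₃ = inj₂ refl

square-move-weight : ∀ a b {n} → suc (a ℕ.+ b) ≡ n →
                     stripWeight a + stripWeight b ≡ 1ℤ + stripWeight n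
                   ⊎ stripWeight a + stripWeight b ≡ -2ℤ + stripWeight n
square-move-weight a b refl rewrite residue-+ a b = square-weights (residue a) (residue b)

domino-move-weight : ∀ a b {n} → suc (suc (a ℕ.+ b)) ≡ n →
                     stripWeight a + stripWeight b ≡ -1ℤ + stripWeight n
                   ⊎ stripWeight a + stripWeight b ≡ 2ℤ + stripWeight n
domino-move-weight a b refl rewrite residue-+ a b = domino-weights (residue a) (residue b)

square-good-weight : ∀ m →
    ∃ (λ (i : Fin (suc m)) → stripWeight (toℕ i) + stripWeight (m ∸ toℕ i) ≡ 1ℤ + stripWeight (suc m))
  ⊎ 0ℤ ℤ.< stripWeight (suc m) ×
    ∃ (λ (i : Fin (suc m)) → stripWeight (toℕ i) + stripWeight (m ∸ toℕ i) ≡ -2ℤ + stripWeight (suc m))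
square-good-weight m with residue m in eq
... | 0₃ = inj₁ (Fin.zero , cong (λ r → 0ℤ + weightOf r) eq)
... | 1₃ = inj₂ (+<+ (s≤s z≤n) , Fin.zero , cong (λ r → 0ℤ + weightOf r) eq)
... | 2₃ = inj₁ (Fin.zero , cong (λ r → 0ℤ + weightOf r) eq)

domino-down-weight : ∀ m →
  ∃ λ (i : Fin (suc m)) → stripWeight (toℕ i) + stripWeight (m ∸ toℕ i) ≡ -1ℤ + stripWeight (suc (suc m))
domino-down-weight zero = Fin.zero , refl
domino-down-weight (suc m) with residue m in eq
... | 0₃ = Fin.zero , cong (λ r → 0ℤ + weightOf (suc₃ r)) eq
... | 1₃ = Fin.suc Fin.zero , cong (λ r → -1ℤ + weightOf r) eq
... | 2₃ = Fin.zero , cong (λ r → 0ℤ + weightOf (suc₃ r)) eq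

square-cells : ∀ {n} (i : Fin n) → suc (toℕ i ℕ.+ (n ∸ 1 ∸ toℕ i)) ≡ n
square-cells {suc n} i = cong suc (ℕₚ.m+[n∸m]≡n (Finₚ.toℕ≤pred[n] i))

domino-cells : ∀ {n} (i : Fin (n ∸ 1)) → suc (suc (toℕ i ℕ.+ (n ∸ 2 ∸ toℕ i))) ≡ n
domino-cells {suc (suc n)} i = cong (suc ∘ suc) (ℕₚ.m+[n∸m]≡n (Finₚ.toℕ≤pred[n] i))

short-strip-weight : ∀ n → n ∸ 1 ≡ 0 → stripWeight n ℤ.≤ 0ℤ
short-strip-weight zero          _ = ℤₚ.≤-refl
short-strip-weight (suc zero)    _ = -≤+
short-strip-weight (suc (suc _)) ()

module StripOptions {f} (ih : ∀ {m} → m ≤ f → Weighted (strip′ f m) (stripWeight m)) where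

  pieces-weighted : ∀ {n} a b {D} → n ≤ suc f → a ℕ.+ b < n → stripWeight a + stripWeight b ≡ D →
                    Weighted (strip′ f a ⊕ strip′ f b) D
  pieces-weighted a b n≤1+f a+b<n refl =
    ⊕-weighted (ih (bound (ℕₚ.m≤m+n a b))) (ih (bound (ℕₚ.m≤n+m b a)))
    where
    bound : ∀ {k} → k ≤ a ℕ.+ b → k ≤ f
    bound k≤a+b = ℕₚ.≤-pred (ℕₚ.≤-trans (s≤s k≤a+b) (ℕₚ.≤-trans a+b<n n≤1+f))

  square-weighted : ∀ {n D} → n ≤ suc f → (i : Fin n) →
                    stripWeight (toℕ i) + stripWeight (n ∸ 1 ∸ toℕ i) ≡ D →
                    Weighted (strip′ f (toℕ i) ⊕ strip′ f (n ∸ 1 ∸ toℕ i)) D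
  square-weighted {n} n≤1+f i =
    pieces-weighted (toℕ i) (n ∸ 1 ∸ toℕ i) n≤1+f (ℕₚ.≤-reflexive (square-cells i))

  domino-weighted : ∀ {n D} → n ≤ suc f → (i : Fin (n ∸ 1)) →
                    stripWeight (toℕ i) + stripWeight (n ∸ 2 ∸ toℕ i) ≡ D →
                    Weighted (strip′ f (toℕ i) ⊕ strip′ f (n ∸ 2 ∸ toℕ i)) D
  domino-weighted {n} n≤1+f i =
    pieces-weighted (toℕ i) (n ∸ 2 ∸ toℕ i) n≤1+f
                    (ℕₚ.≤-trans (ℕₚ.n≤1+n _) (ℕₚ.≤-reflexive (domino-cells {n} i)))

  square-options : ∀ {n} → n ≤ suc f → ∀ i →
                   Weighted (strip′ f (toℕ i) ⊕ strip′ f (n ∸ 1 ∸ toℕ i)) (1ℤ + stripWeight n)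
                 ⊎ Weighted (strip′ f (toℕ i) ⊕ strip′ f (n ∸ 1 ∸ toℕ i)) (-2ℤ + stripWeight n)
  square-options n≤1+f i =
    Sum.map (square-weighted n≤1+f i) (square-weighted n≤1+f i) (square-move-weight (toℕ i) _ (square-cells i))

  domino-options : ∀ {n} → n ≤ suc f → ∀ i →
                   Weighted (strip′ f (toℕ i) ⊕ strip′ f (n ∸ 2 ∸ toℕ i)) (-1ℤ + stripWeight n)
                 ⊎ Weighted (strip′ f (toℕ i) ⊕ strip′ f (n ∸ 2 ∸ toℕ i)) (2ℤ + stripWeight n)
  domino-options {n} n≤1+f i =
    Sum.map (domino-weighted {n} n≤1+f i) (domino-weighted {n} n≤1+f i)
            (domino-move-weight (toℕ i) _ (domino-cells {n} i))

  rightDown : ∀ {n} → n ≤ suc f → 0 < n ∸ 1 →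
              ∃ λ (i : Fin (n ∸ 1)) → Weighted (strip′ f (toℕ i) ⊕ strip′ f (n ∸ 2 ∸ toℕ i)) (-1ℤ + stripWeight n)
  rightDown {suc (suc m)} n≤1+f _ = Prod.map₂ (domino-weighted {suc (suc m)} n≤1+f _) (domino-down-weight m)

  leftGood : ∀ {n} → n ≤ suc f → LeftGood (strip′ (suc f) n) (stripWeight n)
  leftGood {zero}  _      = inj₂ (λ ())
  leftGood {suc m} n≤1+f with square-good-weight m
  ... | inj₁ (i , e)       = inj₁ (i , square-weighted n≤1+f i e)
  ... | inj₂ (w>0 , i , e) = inj₂ (λ _ → w>0 , i , square-weighted n≤1+f i e)

strip′-weighted : ∀ {f n} → n ≤ f → Weighted (strip′ f n) (stripWeight n)
strip′-weighted {zero}  z≤n    = 𝟘-weighted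
strip′-weighted {suc f} {n} n≤1+f =
  weighted (square-options n≤1+f) (domino-options n≤1+f) (λ { refl → refl }) (short-strip-weight n)
           (rightDown n≤1+f) (leftGood n≤1+f)
  where open StripOptions (strip′-weighted {f})

strip-weighted : ∀ n → Weighted (S n) (stripWeight n)
strip-weighted n = strip′-weighted ℕₚ.≤-refl

kayles-weighted : ∀ xs → ∃ (Weighted (kayles xs))
kayles-weighted []       = 0ℤ , 𝟘-weighted
kayles-weighted (n ∷ ns) =
  Prod.map (λ D → stripWeight n + D) (⊕-weighted (strip-weighted n)) (kayles-weighted ns)

weighted-≡mod𝒦 : ∀ {G H D} → Weighted G D → Weighted H D → G ≡mod𝒦 H
weighted-≡mod𝒦 wG wH xs =
  let wX = proj₂ (kayles-weighted xs) in
  trans (o⁻-weighted (⊕-weighted wG wX)) (sym (o⁻-weighted (⊕-weighted wH wX)))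

lemma3p1 : (k j : ℕ) → 1 ≤ k → 1 ≤ j →
    ((k · S 1) ⊕ (j · S 2)) ≡mod𝒦 ⟨ ((k ∸ 1) · S 1) ⊕ (j · S 2) ∣ (k · S 1) ⊕ ((j ∸ 1) · S 2) ⟩
lemma3p1 (suc k) (suc j) _ _ = weighted-≡mod𝒦 position (⟨∣⟩-weighted left right)
  where
  S₁-copies : ∀ m → Weighted (m · S 1) (+ m * -1ℤ)
  S₁-copies m = ·-weighted m (strip-weighted 1)

  S₂-copies : ∀ m → Weighted (m · S 2) (+ m * 1ℤ)
  S₂-copies m = ·-weighted m (strip-weighted 2)

  D : ℤ
  D = + suc k * -1ℤ + + suc j * 1ℤ

  left-weight : ∀ a b → a * -1ℤ + (1ℤ + b) * 1ℤ ≡ 1ℤ + ((1ℤ + a) * -1ℤ + (1ℤ + b) * 1ℤ)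
  left-weight = solve-∀

  right-weight : ∀ a b → (1ℤ + a) * -1ℤ + b * 1ℤ ≡ -1ℤ + ((1ℤ + a) * -1ℤ + (1ℤ + b) * 1ℤ)
  right-weight = solve-∀

  position : Weighted ((suc k · S 1) ⊕ (suc j · S 2)) D
  position = ⊕-weighted (S₁-copies (suc k)) (S₂-copies (suc j))

  left : Weighted ((k · S 1) ⊕ (suc j · S 2)) (1ℤ + D)
  left = subst (Weighted _) (left-weight (+ k) (+ j)) (⊕-weighted (S₁-copies k) (S₂-copies (suc j)))

  right : Weighted ((suc k · S 1) ⊕ (j · S 2)) (-1ℤ + D)
  right = subst (Weighted _) (right-weight (+ k) (+ j)) (⊕-weighted (S₁-copies (suc k)) (S₂-copies j))
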